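{- Fix a moding. Let $A$ and $H$ be variable disjoint atoms such that the input positions of $A$ are ground and $H$ is weakly linear. Then $\{A\doteq H\}$ is WNSTO.
   Context: A moding assigns to each argument position of each predicate either $+$ (input) or $-$ (output). An atom $A$ is weakly linear if every variable occurring more than once in $A$ occurs in an input position of $A$. MMA (Martelli–Montanari algorithm) operates on a finite equation set by nondeterministically choosing an equation and applying: (1) $f(s_1,\ldots,s_n)\doteq f(t_1,\ldots,t_n)$ → replace by $s_i\doteq t_i$; (2) $f(\ldots)\doteq g(\ldots)$, $f\ne g$ → fail; (3) $X\doteq X$ → delete; (4) $t\doteq X$, $t$ not a variable → replace by $X\doteq t$; (5) $X\doteq t$, $X\notin Var(t)$, $X$ occurring elsewhere → apply $\{X/t\}$ to all other equations; (6) $X\doteq t$, $X\in Var(t)$, $X\ne t$ → fail. An equation set is WNSTO if some run of MMA on it does not perform action (6). -}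

module Defs where

open import Data.Nat using (ℕ; zero; suc; _+_; _≤_; _<_; _≟_)
open import Data.List using (List; []; _∷_; _++_; length; map; zip; lookup)
open import Data.Fin using (Fin)
open import Data.Product using (_×_; _,_; Σ; ∃)
open import Data.Sum using (_⊎_)
open import Data.Bool using (true; false)
open import Relation.Nullary using (¬_; does)
open import Relation.Binary.PropositionalEquality using (_≡_; _≢_)
open import Relation.Binary.Construct.Closure.ReflexiveTransitive using (Star)

-- First-order terms: variables are named by ℕ; a function symbol is a
-- name (ℕ) together with its arity (the length of the argument list).
data Term : Set where
  var : ℕ → Term
  fn  : ℕ → List Term → Term

mutual
  occ : ℕ → Term → ℕ
  occ x (var y) with does (x ≟ y)
  ... | true  = 1
  ... | false = 0
  occ x (fn f ts) = occs x ts

  occs : ℕ → List Term → ℕ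
  occs x [] = 0
  occs x (t ∷ ts) = occ x t + occs x ts

mutual
  sub : ℕ → Term → Term → Term
  sub x u (var y) with does (x ≟ y)
  ... | true  = u
  ... | false = var y
  sub x u (fn f ts) = fn f (subs x u ts)

  subs : ℕ → Term → List Term → List Term
  subs x u [] = []
  subs x u (t ∷ ts) = sub x u t ∷ subs x u ts

Ground : Term → Set
Ground t = ∀ x → occ x t ≡ 0

-- Atoms: predicate symbol (name, arity = length of args)
record Atom : Set where
  constructor atom
  field
    pred : ℕ
    args : List Term
open Atom public

atomTerm : Atom → Term
atomTerm (atom p ts) = fn p ts

occA : ℕ → Atom → ℕ
occA x A = occs x (args A)

data Mode : Set where
  In Out : Mode

-- a moding: for predicate p of arity n, a mode for every position
Moding : Set
Moding = (p : ℕ) (n : ℕ) → Fin n → Mode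

InputGround : Moding → Atom → Set
InputGround m A =
  ∀ (i : Fin (length (args A))) → m (pred A) (length (args A)) i ≡ In →
    Ground (lookup (args A) i)

WeaklyLinear : Moding → Atom → Set
WeaklyLinear m A =
  ∀ x → 2 ≤ occA x A →
    Σ (Fin (length (args A))) λ i →
      (m (pred A) (length (args A)) i ≡ In) × (1 ≤ occ x (lookup (args A) i))

VarDisjoint : Atom → Atom → Set
VarDisjoint A H = ∀ x → occA x A ≡ 0 ⊎ occA x H ≡ 0

-- equations s ≐ t, finite equation sets as lists
Eqn : Set
Eqn = Term × Term

EqSet : Set
EqSet = List Eqn

occE : ℕ → EqSet → ℕ
occE x [] = 0
occE x ((s , t) ∷ E) = occ x s + occ x t + occE x E

subE : ℕ → Term → EqSet → EqSet
subE x u = map (λ { (s , t) → sub x u s , sub x u t })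

-- non-failing MMA actions (1), (3), (4), (5); the chosen equation is the
-- one between L and R
data Act : EqSet → EqSet → Set where
  act1 : ∀ L R f ss ts → length ss ≡ length ts →
         Act (L ++ (fn f ss , fn f ts) ∷ R) (L ++ zip ss ts ++ R)
  act3 : ∀ L R x → Act (L ++ (var x , var x) ∷ R) (L ++ R)
  act4 : ∀ L R f ts x →
         Act (L ++ (fn f ts , var x) ∷ R) (L ++ (var x , fn f ts) ∷ R)
  act5 : ∀ L R x t → occ x t ≡ 0 → 0 < occE x L + occE x R →
         Act (L ++ (var x , t) ∷ R) (subE x t L ++ (var x , t) ∷ subE x t R)

data Act2 : EqSet → Set where
  act2 : ∀ L R f g ss ts → (f ≢ g ⊎ length ss ≢ length ts) →
         Act2 (L ++ (fn f ss , fn g ts) ∷ R)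

data Act6 : EqSet → Set where
  act6 : ∀ L R x t → 0 < occ x t → t ≢ var x →
         Act6 (L ++ (var x , t) ∷ R)

Halted : EqSet → Set
Halted E = (∀ E′ → ¬ Act E E′) × ¬ Act2 E × ¬ Act6 E

-- some maximal run of MMA on E performs no action (6): a finite sequence of
-- actions (1),(3),(4),(5) ending either in a failure by action (2) or in a
-- set to which no action applies.
WNSTO : EqSet → Set
WNSTO E = ∃ λ E′ → Star Act E E′ × (Act2 E′ ⊎ Halted E′)

module Submission where

open import Defs
open import Data.Product using (_,_)
open import Data.List using ([]; _∷_)

open import Data.Fin using (Fin; zero; suc; toℕ)
open import Data.Fin.Properties using (toℕ-injective)
open import Data.List using (List; _++_; length; map; zip; lookup)
open import Data.List.Membership.Propositional using (_∈_; _∉_)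
open import Data.List.Membership.Propositional.Properties using (∈-map⁺; ∈-map⁻; ∈-++⁺ˡ; ∈-++⁺ʳ; ∈-++⁻)
open import Data.List.Properties using (map-++; map-∘; map-id; ++-identityʳ)
open import Data.List.Relation.Unary.All as All using (All; []; _∷_)
import Data.List.Relation.Unary.All.Properties as All
open import Data.List.Relation.Unary.Any using (here; there)
open import Data.Nat using (ℕ; zero; suc; _+_; _≤_; _<_; _≟_; _≤?_; z≤n; s≤s)
open import Data.Nat.Induction using (<-wellFounded)
open import Data.Nat.Properties
open import Algebra.Properties.CommutativeSemigroup +-commutativeSemigroup using (interchange; x∙yz≈y∙xz)
open import Data.Product using (Σ; ∃; _×_; proj₁; proj₂; map₂)
open import Data.Sum using (_⊎_; inj₁; inj₂)
open import Function using (_∘_)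
open import Induction.WellFounded using (Acc; acc)
open import Relation.Binary.Construct.Closure.ReflexiveTransitive using (Star; ε; _◅_; _◅◅_)
open import Relation.Binary.Definitions using (DecidableEquality)
open import Relation.Binary.PropositionalEquality
open import Relation.Nullary using (¬_; yes; no; contradiction)
open import Relation.Nullary.Decidable using (dec-true; dec-false)

-- After decomposing A ≐ H into the argument equations aᵢ ≐ hᵢ, the run first works on the
-- equations at input positions. Their left sides are ground, so they only decompose, clash, or
-- bind a variable of H to a ground term; since every variable occurring twice in H occurs at an
-- input position, afterwards the right sides of the remaining (output) equations are linear and
-- share no variable with the left sides. Then no occur check can fail: binding a left variable
-- y := r is safe because y is not in r, and the variables of r occur nowhere else on the right;
-- binding a right variable X := s is safe because X does not occur on the left at all. Each phase
-- terminates because it shrinks the size of the input left sides, resp. output right sides, and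
-- when only bound equations x ≐ r remain, with x occurring nowhere else, no action applies.

occ-self : ∀ x → occ x (var x) ≡ 1
occ-self x rewrite dec-true (x ≟ x) refl = refl

occ-var-≢ : ∀ {x y} → x ≢ y → occ x (var y) ≡ 0
occ-var-≢ {x} {y} x≢y rewrite dec-false (x ≟ y) x≢y = refl

occ-var≡0⇒≢ : ∀ {x y} → occ x (var y) ≡ 0 → x ≢ y
occ-var≡0⇒≢ {x} occ≡0 refl = 1+n≢0 (trans (sym (occ-self x)) occ≡0)

sub-self : ∀ y u → sub y u (var y) ≡ u
sub-self y u rewrite dec-true (y ≟ y) refl = refl

sub-var-≢ : ∀ {y v} u → y ≢ v → sub y u (var v) ≡ var v
sub-var-≢ {y} {v} u y≢v rewrite dec-false (y ≟ v) y≢v = refl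

mutual
  sub-fresh : ∀ {y} u s → occ y s ≡ 0 → sub y u s ≡ s
  sub-fresh {y} u (var v) y∉s = sub-var-≢ {y} u (occ-var≡0⇒≢ y∉s)
  sub-fresh u (fn f ts) y∉s = cong (fn f) (subs-fresh u ts y∉s)

  subs-fresh : ∀ {y} u ts → occs y ts ≡ 0 → subs y u ts ≡ ts
  subs-fresh u []       _   = refl
  subs-fresh u (t ∷ ts) y∉ts =
    cong₂ _∷_ (sub-fresh u t (m+n≡0⇒m≡0 _ y∉ts)) (subs-fresh u ts (m+n≡0⇒n≡0 _ y∉ts))

mutual
  occ-sub-≢ : ∀ {z y u} s → z ≢ y → occ z u ≡ 0 → occ z (sub y u s) ≡ occ z s
  occ-sub-≢ {z} {y} {u} (var v) z≢y z∉u with y ≟ v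
  ... | yes refl = trans (cong (occ z) (sub-self y u)) (trans z∉u (sym (occ-var-≢ z≢y)))
  ... | no y≢v   = cong (occ z) (sub-var-≢ u y≢v)
  occ-sub-≢ (fn f ts) z≢y z∉u = occs-subs-≢ ts z≢y z∉u

  occs-subs-≢ : ∀ {z y u} ts → z ≢ y → occ z u ≡ 0 → occs z (subs y u ts) ≡ occs z ts
  occs-subs-≢ []       _   _   = refl
  occs-subs-≢ (t ∷ ts) z≢y z∉u = cong₂ _+_ (occ-sub-≢ t z≢y z∉u) (occs-subs-≢ ts z≢y z∉u)

mutual
  occ-sub-self : ∀ {y u} s → occ y u ≡ 0 → occ y (sub y u s) ≡ 0
  occ-sub-self {y} {u} (var v) y∉u with y ≟ v
  ... | yes refl = trans (cong (occ y) (sub-self y u)) y∉u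
  ... | no y≢v   = trans (cong (occ y) (sub-var-≢ u y≢v)) (occ-var-≢ y≢v)
  occ-sub-self (fn f ts) y∉u = occs-subs-self ts y∉u

  occs-subs-self : ∀ {y u} ts → occ y u ≡ 0 → occs y (subs y u ts) ≡ 0
  occs-subs-self []       _   = refl
  occs-subs-self (t ∷ ts) y∉u = cong₂ _+_ (occ-sub-self t y∉u) (occs-subs-self ts y∉u)

subs-++ : ∀ y u ss ts → subs y u (ss ++ ts) ≡ subs y u ss ++ subs y u ts
subs-++ y u []       ts = refl
subs-++ y u (s ∷ ss) ts = cong (sub y u s ∷_) (subs-++ y u ss ts)

occs-++ : ∀ x ss ts → occs x (ss ++ ts) ≡ occs x ss + occs x ts
occs-++ x []       ts = refl
occs-++ x (s ∷ ss) ts = trans (cong (occ x s +_) (occs-++ x ss ts)) (sym (+-assoc (occ x s) _ _))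

mutual
  size : Term → ℕ
  size (var _)   = 1
  size (fn _ ts) = suc (sizes ts)

  sizes : List Term → ℕ
  sizes []       = 0
  sizes (t ∷ ts) = size t + sizes ts

sizes-++ : ∀ ss ts → sizes (ss ++ ts) ≡ sizes ss + sizes ts
sizes-++ []       ts = refl
sizes-++ (s ∷ ss) ts = trans (cong (size s +_) (sizes-++ ss ts)) (sym (+-assoc (size s) _ _))

occs-middle : ∀ x A t C → occs x (A ++ t ∷ C) ≡ occ x t + occs x (A ++ C)
occs-middle x A t C =
  trans (occs-++ x A (t ∷ C))
        (trans (x∙yz≈y∙xz (occs x A) (occ x t) (occs x C)) (cong (occ x t +_) (sym (occs-++ x A C))))

sizes-middle : ∀ A t C → sizes (A ++ t ∷ C) ≡ size t + sizes (A ++ C)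
sizes-middle A t C =
  trans (sizes-++ A (t ∷ C))
        (trans (x∙yz≈y∙xz (sizes A) (size t) (sizes C)) (cong (size t +_) (sym (sizes-++ A C))))

occs-splice : ∀ x f A B C → occs x (A ++ B ++ C) ≡ occs x (A ++ fn f B ∷ C)
occs-splice x f A B C =
  trans (occs-++ x A (B ++ C)) (trans (cong (occs x A +_) (occs-++ x B C)) (sym (occs-++ x A _)))

sizes-splice : ∀ f A B C → sizes (A ++ B ++ C) < sizes (A ++ fn f B ∷ C)
sizes-splice f A B C rewrite sizes-++ A (B ++ C) | sizes-++ B C | sizes-++ A (fn f B ∷ C) =
  +-monoʳ-< (sizes A) ≤-refl

size-pos : ∀ t → 1 ≤ size t
size-pos (var _)  = s≤s z≤n
size-pos (fn _ _) = s≤s z≤n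

occE-++ : ∀ x L R → occE x (L ++ R) ≡ occE x L + occE x R
occE-++ x []            R = refl
occE-++ x ((s , t) ∷ L) R =
  trans (cong (occ x s + occ x t +_) (occE-++ x L R)) (sym (+-assoc (occ x s + occ x t) _ _))

occE-middle : ∀ x L s t R → occE x (L ++ (s , t) ∷ R) ≡ occ x s + occ x t + occE x (L ++ R)
occE-middle x L s t R =
  trans (occE-++ x L ((s , t) ∷ R))
        (trans (x∙yz≈y∙xz (occE x L) (occ x s + occ x t) (occE x R))
               (cong (occ x s + occ x t +_) (sym (occE-++ x L R))))

occE-∈ : ∀ {x r E} → (var x , r) ∈ E → 1 ≤ occE x E
occE-∈ {x} (here refl) rewrite occ-self x = s≤s z≤n
occE-∈ {x} {E = (s , t) ∷ _} (there x∈E) = ≤-trans (occE-∈ x∈E) (m≤n+m _ (occ x s + occ x t))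

occE-zip : ∀ x ss ts → length ss ≡ length ts → occE x (zip ss ts) ≡ occs x ss + occs x ts
occE-zip x []       []       _ = refl
occE-zip x (s ∷ ss) (t ∷ ts) e =
  trans (cong (occ x s + occ x t +_) (occE-zip x ss ts (suc-injective e)))
        (interchange (occ x s) (occ x t) (occs x ss) (occs x ts))

subE-fresh : ∀ {v} u L → occE v L ≡ 0 → subE v u L ≡ L
subE-fresh u []            _   = refl
subE-fresh u ((s , t) ∷ L) v∉L =
  cong₂ _∷_ (cong₂ _,_ (sub-fresh u s (m+n≡0⇒m≡0 _ v∉st)) (sub-fresh u t (m+n≡0⇒n≡0 _ v∉st)))
            (subE-fresh u L (m+n≡0⇒n≡0 _ v∉L))
  where v∉st = m+n≡0⇒m≡0 _ v∉L

occE-subE-≢ : ∀ {z v u} L → z ≢ v → occ z u ≡ 0 → occE z (subE v u L) ≡ occE z L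
occE-subE-≢ []            _   _   = refl
occE-subE-≢ ((s , t) ∷ L) z≢v z∉u =
  cong₂ _+_ (cong₂ _+_ (occ-sub-≢ s z≢v z∉u) (occ-sub-≢ t z≢v z∉u)) (occE-subE-≢ L z≢v z∉u)

occE-subE-self : ∀ {v u} L → occ v u ≡ 0 → occE v (subE v u L) ≡ 0
occE-subE-self []            _   = refl
occE-subE-self ((s , t) ∷ L) v∉u =
  cong₂ _+_ (cong₂ _+_ (occ-sub-self s v∉u) (occ-sub-self t v∉u)) (occE-subE-self L v∉u)

occE-eliminate-≢ : ∀ {x v u} L R → x ≢ v → occ x u ≡ 0 →
  occE x (subE v u L ++ (var v , u) ∷ subE v u R) ≡ occE x (L ++ R)
occE-eliminate-≢ {x} {v} {u} L R x≢v x∉u = begin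
  occE x (subE v u L ++ (var v , u) ∷ subE v u R)
    ≡⟨ occE-middle x (subE v u L) (var v) u (subE v u R) ⟩
  occ x (var v) + occ x u + occE x (subE v u L ++ subE v u R)
    ≡⟨ cong₂ (λ m n → m + n + occE x (subE v u L ++ subE v u R)) (occ-var-≢ x≢v) x∉u ⟩
  occE x (subE v u L ++ subE v u R)
    ≡⟨ cong (occE x) (sym (map-++ _ L R)) ⟩
  occE x (subE v u (L ++ R))
    ≡⟨ occE-subE-≢ (L ++ R) x≢v x∉u ⟩
  occE x (L ++ R)
    ∎
  where open ≡-Reasoning

occE-eliminate-self : ∀ {v u} L R → occ v u ≡ 0 → occE v (subE v u L ++ (var v , u) ∷ subE v u R) ≡ 1
occE-eliminate-self {v} {u} L R v∉u = begin
  occE v (subE v u L ++ (var v , u) ∷ subE v u R)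
    ≡⟨ occE-middle v (subE v u L) (var v) u (subE v u R) ⟩
  occ v (var v) + occ v u + occE v (subE v u L ++ subE v u R)
    ≡⟨ cong (λ E → occ v (var v) + occ v u + occE v E) (sym (map-++ _ L R)) ⟩
  occ v (var v) + occ v u + occE v (subE v u (L ++ R))
    ≡⟨ cong₂ (λ m n → m + n + occE v (subE v u (L ++ R))) (occ-self v) v∉u ⟩
  1 + occE v (subE v u (L ++ R))
    ≡⟨ cong suc (occE-subE-self (L ++ R) v∉u) ⟩
  1
    ∎
  where open ≡-Reasoning

WNSTO-◅◅ : ∀ {E E′} → Star Act E E′ → WNSTO E′ → WNSTO E
WNSTO-◅◅ run (F , run′ , end) = F , run ◅◅ run′ , end

-- Action (5) only applies when v occurs elsewhere; otherwise the substitution is the identity.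
eliminate⋆ : ∀ L R v u → occ v u ≡ 0 →
  Star Act (L ++ (var v , u) ∷ R) (subE v u L ++ (var v , u) ∷ subE v u R)
eliminate⋆ L R v u v∉u with occE v L + occE v R in v∈LR
... | zero rewrite subE-fresh u L (m+n≡0⇒m≡0 _ v∈LR) | subE-fresh u R (m+n≡0⇒n≡0 _ v∈LR) = ε
... | suc _ = act5 L R v u v∉u (subst (0 <_) (sym v∈LR) (s≤s z≤n)) ◅ ε

SolvedIn : EqSet → Eqn → Set
SolvedIn E e = ∃ λ x → ∃ λ r → e ≡ (var x , r) × occE x E ≡ 1

solved-isolated : ∀ L R x t → SolvedIn (L ++ (var x , t) ∷ R) (var x , t) →
  occ x t + occE x (L ++ R) ≡ 0
solved-isolated L R x t (_ , _ , refl , once) = suc-injective (begin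
  suc (occ x t + occE x (L ++ R))
    ≡⟨ cong (λ n → n + occ x t + occE x (L ++ R)) (sym (occ-self x)) ⟩
  occ x (var x) + occ x t + occE x (L ++ R)
    ≡⟨ sym (occE-middle x L (var x) t R) ⟩
  occE x (L ++ (var x , t) ∷ R)
    ≡⟨ once ⟩
  1
    ∎)
  where open ≡-Reasoning

solved-halts : ∀ E → All (SolvedIn E) E → Halted E
solved-halts E allSolved = (λ _ → no-Act allSolved) , no-Act2 allSolved , no-Act6 allSolved
  where
  solvedAt : ∀ {L e R} → All (SolvedIn (L ++ e ∷ R)) (L ++ e ∷ R) → SolvedIn (L ++ e ∷ R) e
  solvedAt {L} all = All.lookup all (∈-++⁺ʳ L (here refl))

  isolatedAt : ∀ {L x t R} → All (SolvedIn (L ++ (var x , t) ∷ R)) (L ++ (var x , t) ∷ R) →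
    occ x t + occE x (L ++ R) ≡ 0
  isolatedAt {L} {x} {t} {R} all = solved-isolated L R x t (solvedAt all)

  no-Act : ∀ {E E′} → All (SolvedIn E) E → ¬ Act E E′
  no-Act all (act1 L R f ss ts _) with _ , _ , () , _ ← solvedAt all
  no-Act all (act3 L R x)         = occ-var≡0⇒≢ {x} (m+n≡0⇒m≡0 _ (isolatedAt all)) refl
  no-Act all (act4 L R f ts x)    with _ , _ , () , _ ← solvedAt all
  no-Act all (act5 L R x t _ x∈LR) =
    <⇒≢ x∈LR (sym (trans (sym (occE-++ x L R)) (m+n≡0⇒n≡0 (occ x t) (isolatedAt all))))

  no-Act2 : ∀ {E} → All (SolvedIn E) E → ¬ Act2 E
  no-Act2 all (act2 L R f g ss ts _) with _ , _ , () , _ ← solvedAt all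

  no-Act6 : ∀ {E} → All (SolvedIn E) E → ¬ Act6 E
  no-Act6 all (act6 L R x t x∈t _) = <⇒≢ x∈t (sym (m+n≡0⇒m≡0 _ (isolatedAt all)))

m+n≡1⇒m≡0∧n≡1 : ∀ m {n} → 1 ≤ n → m + n ≡ 1 → m ≡ 0 × n ≡ 1
m+n≡1⇒m≡0∧n≡1 zero    _   m+n≡1 = refl , m+n≡1
m+n≡1⇒m≡0∧n≡1 (suc m) 1≤n m+n≡1 = contradiction (m+n≡0⇒n≡0 m (suc-injective m+n≡1)) (≢-sym (<⇒≢ 1≤n))

solved-apart : ∀ {x r} L s t R → (var x , r) ∈ L ++ R → occE x (L ++ (s , t) ∷ R) ≡ 1 →
  occ x s + occ x t ≡ 0 × occE x (L ++ R) ≡ 1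
solved-apart {x} L s t R x∈LR once =
  m+n≡1⇒m≡0∧n≡1 (occ x s + occ x t) (occE-∈ x∈LR) (trans (sym (occE-middle x L s t R)) once)

data Tag : Set where
  solved input output : Tag

_≟ᵗ_ : DecidableEquality Tag
solved ≟ᵗ solved = yes refl
input  ≟ᵗ input  = yes refl
output ≟ᵗ output = yes refl
solved ≟ᵗ input  = no λ ()
solved ≟ᵗ output = no λ ()
input  ≟ᵗ solved = no λ ()
input  ≟ᵗ output = no λ ()
output ≟ᵗ solved = no λ ()
output ≟ᵗ input  = no λ ()

State : Set
State = List (Tag × Eqn)

eqs : State → EqSet
eqs = map proj₂

subEqn : ℕ → Term → Eqn → Eqn
subEqn v u (s , t) = sub v u s , sub v u t

substˢ : ℕ → Term → State → State
substˢ v u = map (map₂ (subEqn v u))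

eliminated : State → ℕ → Term → State → State
eliminated T₁ v u T₂ = substˢ v u T₁ ++ (solved , var v , u) ∷ substˢ v u T₂

zipˢ : Tag → List Term → List Term → State
zipˢ k ss ts = map (k ,_) (zip ss ts)

data Side : Set where
  lhs rhs : Side

side : Side → {A : Set} → A × A → A
side lhs (s , _) = s
side rhs (_ , t) = t

terms : Side → Tag → State → List Term
terms σ k []            = []
terms σ k ((k′ , e) ∷ T) with k ≟ᵗ k′
... | yes _ = side σ e ∷ terms σ k T
... | no  _ = terms σ k T

count : ℕ → Side → Tag → State → ℕ
count x σ k T = occs x (terms σ k T)

eqs-middle : ∀ T₁ k e T₂ → eqs (T₁ ++ (k , e) ∷ T₂) ≡ eqs T₁ ++ e ∷ eqs T₂
eqs-middle T₁ k e T₂ = map-++ proj₂ T₁ _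

eqs-substˢ : ∀ v u T → eqs (substˢ v u T) ≡ subE v u (eqs T)
eqs-substˢ v u []      = refl
eqs-substˢ v u (_ ∷ T) = cong (_ ∷_) (eqs-substˢ v u T)

eqs-zipˢ : ∀ k ss ts → eqs (zipˢ k ss ts) ≡ zip ss ts
eqs-zipˢ k ss ts = trans (sym (map-∘ (zip ss ts))) (map-id (zip ss ts))

side-∷ : ∀ σ {s t : Term} {ss ts : List Term} → side σ (s ∷ ss , t ∷ ts) ≡ side σ (s , t) ∷ side σ (ss , ts)
side-∷ lhs = refl
side-∷ rhs = refl

side-fn : ∀ σ f ss ts → side σ (fn f ss , fn f ts) ≡ fn f (side σ (ss , ts))
side-fn lhs f ss ts = refl
side-fn rhs f ss ts = refl

side-subEqn : ∀ σ v u e → side σ (subEqn v u e) ≡ sub v u (side σ e)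
side-subEqn lhs v u e = refl
side-subEqn rhs v u e = refl

terms-++ : ∀ σ k T₁ T₂ → terms σ k (T₁ ++ T₂) ≡ terms σ k T₁ ++ terms σ k T₂
terms-++ σ k []              T₂ = refl
terms-++ σ k ((k′ , e) ∷ T₁) T₂ with k ≟ᵗ k′
... | yes _ = cong (side σ e ∷_) (terms-++ σ k T₁ T₂)
... | no  _ = terms-++ σ k T₁ T₂

terms-here : ∀ σ k T₁ e T₂ → terms σ k (T₁ ++ (k , e) ∷ T₂) ≡ terms σ k T₁ ++ side σ e ∷ terms σ k T₂
terms-here σ k T₁ e T₂ rewrite terms-++ σ k T₁ ((k , e) ∷ T₂) with k ≟ᵗ k
... | yes _   = refl
... | no  k≢k = contradiction refl k≢k

terms-there : ∀ σ {k′ k} T₁ e T₂ → k′ ≢ k →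
  terms σ k′ (T₁ ++ (k , e) ∷ T₂) ≡ terms σ k′ T₁ ++ terms σ k′ T₂
terms-there σ {k′} {k} T₁ e T₂ k′≢k rewrite terms-++ σ k′ T₁ ((k , e) ∷ T₂) with k′ ≟ᵗ k
... | yes k′≡k = contradiction k′≡k k′≢k
... | no  _    = refl

terms-substˢ : ∀ σ k v u T → terms σ k (substˢ v u T) ≡ subs v u (terms σ k T)
terms-substˢ σ k v u []             = refl
terms-substˢ σ k v u ((k′ , e) ∷ T) with k ≟ᵗ k′
... | yes _ = cong₂ _∷_ (side-subEqn σ v u e) (terms-substˢ σ k v u T)
... | no  _ = terms-substˢ σ k v u T

terms-eliminated : ∀ σ {k} T₁ v u T₂ → k ≢ solved →
  terms σ k (eliminated T₁ v u T₂) ≡ subs v u (terms σ k T₁ ++ terms σ k T₂)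
terms-eliminated σ {k} T₁ v u T₂ k≢solved = begin
  terms σ k (eliminated T₁ v u T₂)
    ≡⟨ terms-there σ (substˢ v u T₁) (var v , u) (substˢ v u T₂) k≢solved ⟩
  terms σ k (substˢ v u T₁) ++ terms σ k (substˢ v u T₂)
    ≡⟨ cong₂ _++_ (terms-substˢ σ k v u T₁) (terms-substˢ σ k v u T₂) ⟩
  subs v u (terms σ k T₁) ++ subs v u (terms σ k T₂)
    ≡⟨ sym (subs-++ v u (terms σ k T₁) _) ⟩
  subs v u (terms σ k T₁ ++ terms σ k T₂)
    ∎
  where open ≡-Reasoning

terms-zipˢ-here : ∀ σ k ss ts → length ss ≡ length ts → terms σ k (zipˢ k ss ts) ≡ side σ (ss , ts)
terms-zipˢ-here lhs k []       []       _ = refl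
terms-zipˢ-here rhs k []       []       _ = refl
terms-zipˢ-here σ   k (s ∷ ss) (t ∷ ts) e with k ≟ᵗ k
... | yes _   =
  trans (cong (side σ (s , t) ∷_) (terms-zipˢ-here σ k ss ts (suc-injective e))) (sym (side-∷ σ))
... | no  k≢k = contradiction refl k≢k

terms-zipˢ-there : ∀ σ {k′ k} ss ts → k′ ≢ k → terms σ k′ (zipˢ k ss ts) ≡ []
terms-zipˢ-there σ []       _        _    = refl
terms-zipˢ-there σ (_ ∷ _)  []       _    = refl
terms-zipˢ-there σ {k′} {k} (s ∷ ss) (t ∷ ts) k′≢k with k′ ≟ᵗ k
... | yes k′≡k = contradiction k′≡k k′≢k
... | no  _    = terms-zipˢ-there σ ss ts k′≢k

count-redex : ∀ x σ T₁ k e T₂ →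
  count x σ k (T₁ ++ (k , e) ∷ T₂) ≡ occ x (side σ e) + occs x (terms σ k T₁ ++ terms σ k T₂)
count-redex x σ T₁ k e T₂ =
  trans (cong (occs x) (terms-here σ k T₁ e T₂)) (occs-middle x (terms σ k T₁) (side σ e) (terms σ k T₂))

rest-≤-count : ∀ x σ T₁ k e T₂ →
  occs x (terms σ k T₁ ++ terms σ k T₂) ≤ count x σ k (T₁ ++ (k , e) ∷ T₂)
rest-≤-count x σ T₁ k e T₂ = ≤-trans (m≤n+m _ _) (≤-reflexive (sym (count-redex x σ T₁ k e T₂)))

rest-<-sizes : ∀ σ T₁ k e T₂ →
  sizes (terms σ k T₁ ++ terms σ k T₂) < sizes (terms σ k (T₁ ++ (k , e) ∷ T₂))
rest-<-sizes σ T₁ k e T₂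
  rewrite terms-here σ k T₁ e T₂ | sizes-middle (terms σ k T₁) (side σ e) (terms σ k T₂) =
  m<n+m _ (size-pos (side σ e))

clash-step : ∀ T₁ k f g ss ts T₂ → f ≢ g ⊎ length ss ≢ length ts →
  WNSTO (eqs (T₁ ++ (k , fn f ss , fn g ts) ∷ T₂))
clash-step T₁ k f g ss ts T₂ clash rewrite eqs-middle T₁ k (fn f ss , fn g ts) T₂ =
  _ , ε , inj₁ (act2 _ _ f g ss ts clash)

orient-step : ∀ T₁ k f ts v T₂ →
  WNSTO (eqs (T₁ ++ (k , var v , fn f ts) ∷ T₂)) → WNSTO (eqs (T₁ ++ (k , fn f ts , var v) ∷ T₂))
orient-step T₁ k f ts v T₂
  rewrite eqs-middle T₁ k (var v , fn f ts) T₂ | eqs-middle T₁ k (fn f ts , var v) T₂ =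
  WNSTO-◅◅ (act4 _ _ f ts v ◅ ε)

SolvedOnce : State → Set
SolvedOnce T = ∀ {e} → (solved , e) ∈ T → SolvedIn (eqs T) e

SolvedOnce-transfer : ∀ {T T′} → (∀ x → occE x (eqs T′) ≡ occE x (eqs T)) →
  (∀ {e} → (solved , e) ∈ T′ → (solved , e) ∈ T) → SolvedOnce T → SolvedOnce T′
SolvedOnce-transfer same-occ solved⊆ once e∈T′ with x , r , refl , x-once ← once (solved⊆ e∈T′) =
  x , r , refl , trans (same-occ x) x-once

-- Input and output equations descend from an argument equation aᵢ ≐ hᵢ at an input, resp. output,
-- position, with the side of A on the left; solved equations x ≐ r have been used to eliminate x.
record Invariant (T : State) : Set where
  field
    solved-once    : SolvedOnce T
    inputs-ground  : ∀ x → count x lhs input T ≡ 0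
    outputs-apart  : ∀ x → count x lhs output T ≡ 0 ⊎ count x rhs output T ≡ 0
    outputs-linear : ∀ x → count x rhs input T ≡ 0 → count x rhs output T ≤ 1
open Invariant

module Decomposition (T₁ : State) (k : Tag) (f : ℕ) (ss ts : List Term) (T₂ : State)
                     (same-arity : length ss ≡ length ts) where

  redex decomposed : State
  redex      = T₁ ++ (k , fn f ss , fn f ts) ∷ T₂
  decomposed = T₁ ++ zipˢ k ss ts ++ T₂

  eqs-decomposed : eqs decomposed ≡ eqs T₁ ++ zip ss ts ++ eqs T₂
  eqs-decomposed rewrite map-++ proj₂ T₁ (zipˢ k ss ts ++ T₂) | map-++ proj₂ (zipˢ k ss ts) T₂ =
    cong (λ Z → eqs T₁ ++ Z ++ eqs T₂) (eqs-zipˢ k ss ts)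

  decompose-step : WNSTO (eqs decomposed) → WNSTO (eqs redex)
  decompose-step rewrite eqs-decomposed | eqs-middle T₁ k (fn f ss , fn f ts) T₂ =
    WNSTO-◅◅ (act1 _ _ f ss ts same-arity ◅ ε)

  terms-decomposed : ∀ σ → terms σ k decomposed ≡ terms σ k T₁ ++ side σ (ss , ts) ++ terms σ k T₂
  terms-decomposed σ rewrite terms-++ σ k T₁ (zipˢ k ss ts ++ T₂) | terms-++ σ k (zipˢ k ss ts) T₂
                           | terms-zipˢ-here σ k ss ts same-arity = refl

  terms-redex : ∀ σ → terms σ k redex ≡ terms σ k T₁ ++ fn f (side σ (ss , ts)) ∷ terms σ k T₂
  terms-redex σ rewrite terms-here σ k T₁ (fn f ss , fn f ts) T₂ | side-fn σ f ss ts = refl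

  count-decomposed : ∀ x σ k′ → count x σ k′ decomposed ≡ count x σ k′ redex
  count-decomposed x σ k′ with k′ ≟ᵗ k
  ... | yes refl rewrite terms-decomposed σ | terms-redex σ =
    occs-splice x f (terms σ k T₁) (side σ (ss , ts)) (terms σ k T₂)
  ... | no k′≢k rewrite terms-++ σ k′ T₁ (zipˢ k ss ts ++ T₂) | terms-++ σ k′ (zipˢ k ss ts) T₂
                      | terms-zipˢ-there σ ss ts k′≢k
                      | terms-there σ T₁ (fn f ss , fn f ts) T₂ k′≢k = refl

  sizes-decomposed : ∀ σ → sizes (terms σ k decomposed) < sizes (terms σ k redex)
  sizes-decomposed σ rewrite terms-decomposed σ | terms-redex σ =
    sizes-splice f (terms σ k T₁) (side σ (ss , ts)) (terms σ k T₂)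

  occE-decomposed : ∀ x → occE x (eqs decomposed) ≡ occE x (eqs redex)
  occE-decomposed x rewrite eqs-decomposed | eqs-middle T₁ k (fn f ss , fn f ts) T₂
                          | occE-++ x (eqs T₁) (zip ss ts ++ eqs T₂) | occE-++ x (zip ss ts) (eqs T₂)
                          | occE-zip x ss ts same-arity = sym (occE-++ x (eqs T₁) _)

  solved-decomposed : k ≢ solved → ∀ {e} → (solved , e) ∈ decomposed → (solved , e) ∈ redex
  solved-decomposed k≢solved e∈ with ∈-++⁻ T₁ e∈
  ... | inj₁ e∈T₁ = ∈-++⁺ˡ e∈T₁
  ... | inj₂ e∈ZT₂ with ∈-++⁻ (zipˢ k ss ts) e∈ZT₂
  ...   | inj₁ e∈Z  with _ , _ , refl ← ∈-map⁻ (k ,_) e∈Z = contradiction refl k≢solved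
  ...   | inj₂ e∈T₂ = ∈-++⁺ʳ T₁ (there e∈T₂)

  Invariant-decomposed : k ≢ solved → Invariant redex → Invariant decomposed
  Invariant-decomposed k≢solved inv = record
    { solved-once    = SolvedOnce-transfer occE-decomposed (solved-decomposed k≢solved) (inv .solved-once)
    ; inputs-ground  = λ x → trans (count-decomposed x lhs input) (inv .inputs-ground x)
    ; outputs-apart  = λ x → subst₂ (λ m n → m ≡ 0 ⊎ n ≡ 0) (sym (count-decomposed x lhs output))
                                    (sym (count-decomposed x rhs output)) (inv .outputs-apart x)
    ; outputs-linear = λ x x∉RI → subst (_≤ 1) (sym (count-decomposed x rhs output))
                                    (inv .outputs-linear x (trans (sym (count-decomposed x rhs input)) x∉RI))
    }

module Elimination (T₁ : State) (v : ℕ) (u : Term) (T₂ : State) (v∉u : occ v u ≡ 0) where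

  rest : Side → Tag → List Term
  rest σ k = terms σ k T₁ ++ terms σ k T₂

  eqs-eliminated : eqs (eliminated T₁ v u T₂) ≡ subE v u (eqs T₁) ++ (var v , u) ∷ subE v u (eqs T₂)
  eqs-eliminated = trans (eqs-middle (substˢ v u T₁) solved (var v , u) (substˢ v u T₂))
                         (cong₂ (λ L R → L ++ (var v , u) ∷ R) (eqs-substˢ v u T₁) (eqs-substˢ v u T₂))

  eliminate-step : ∀ k → WNSTO (eqs (eliminated T₁ v u T₂)) → WNSTO (eqs (T₁ ++ (k , var v , u) ∷ T₂))
  eliminate-step k rewrite eqs-middle T₁ k (var v , u) T₂ | eqs-eliminated =
    WNSTO-◅◅ (eliminate⋆ _ _ v u v∉u)

  count-eliminated-≢ : ∀ {z} σ {k} → k ≢ solved → z ≢ v → occ z u ≡ 0 →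
    count z σ k (eliminated T₁ v u T₂) ≡ occs z (rest σ k)
  count-eliminated-≢ σ k≢solved z≢v z∉u rewrite terms-eliminated σ T₁ v u T₂ k≢solved =
    occs-subs-≢ (rest σ _) z≢v z∉u

  count-eliminated-self : ∀ σ {k} → k ≢ solved → count v σ k (eliminated T₁ v u T₂) ≡ 0
  count-eliminated-self σ k≢solved rewrite terms-eliminated σ T₁ v u T₂ k≢solved =
    occs-subs-self (rest σ _) v∉u

  terms-eliminated-fresh : ∀ σ {k} → k ≢ solved → occs v (rest σ k) ≡ 0 →
    terms σ k (eliminated T₁ v u T₂) ≡ rest σ k
  terms-eliminated-fresh σ k≢solved v∉rest =
    trans (terms-eliminated σ T₁ v u T₂ k≢solved) (subs-fresh u (rest σ _) v∉rest)

  occ-oriented : ∀ {a b} x → (a , b) ≡ (var v , u) ⊎ (a , b) ≡ (u , var v) →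
    occ x a + occ x b ≡ occ x (var v) + occ x u
  occ-oriented x (inj₁ refl) = refl
  occ-oriented x (inj₂ refl) = +-comm (occ x u) _

  module _ {k a b} (oriented : (a , b) ≡ (var v , u) ⊎ (a , b) ≡ (u , var v))
           (once : SolvedOnce (T₁ ++ (k , a , b) ∷ T₂)) where
    private
      ∈-redex-state : ∀ {e} → e ∈ T₁ ++ T₂ → e ∈ T₁ ++ (k , a , b) ∷ T₂
      ∈-redex-state e∈ with ∈-++⁻ T₁ e∈
      ... | inj₁ e∈T₁ = ∈-++⁺ˡ e∈T₁
      ... | inj₂ e∈T₂ = ∈-++⁺ʳ T₁ (there e∈T₂)

      -- A solved variable occurs only in its own equation, so it is neither v nor inside u.
      kept : ∀ {e} → (solved , e) ∈ T₁ ++ T₂ → SolvedIn (eqs (eliminated T₁ v u T₂)) (subEqn v u e)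
      kept e∈ with x , r , refl , x-once ← once (∈-redex-state e∈) =
        x , sub v u r , cong (_, sub v u r) (sub-var-≢ u (≢-sym x≢v)) ,
        trans (cong (occE x) eqs-eliminated)
              (trans (occE-eliminate-≢ (eqs T₁) (eqs T₂) x≢v x∉u) (proj₂ apart))
        where
        apart = solved-apart (eqs T₁) a b (eqs T₂)
                  (subst ((var x , r) ∈_) (map-++ proj₂ T₁ T₂) (∈-map⁺ proj₂ e∈))
                  (trans (cong (occE x) (sym (eqs-middle T₁ k (a , b) T₂))) x-once)
        x∉vu = trans (sym (occ-oriented x oriented)) (proj₁ apart)
        x≢v  = occ-var≡0⇒≢ (m+n≡0⇒m≡0 (occ x (var v)) x∉vu)
        x∉u  = m+n≡0⇒n≡0 (occ x (var v)) x∉vu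

    SolvedOnce-eliminated : SolvedOnce (eliminated T₁ v u T₂)
    SolvedOnce-eliminated e∈ with ∈-++⁻ (substˢ v u T₁) e∈
    ... | inj₂ (here refl) =
      v , u , refl , trans (cong (occE v) eqs-eliminated) (occE-eliminate-self (eqs T₁) (eqs T₂) v∉u)
    ... | inj₁ e∈T₁′ with _ , e₀∈ , refl ← ∈-map⁻ (map₂ (subEqn v u)) e∈T₁′ =
      kept (∈-++⁺ˡ e₀∈)
    ... | inj₂ (there e∈T₂′) with _ , e₀∈ , refl ← ∈-map⁻ (map₂ (subEqn v u)) e∈T₂′ =
      kept (∈-++⁺ʳ T₁ e₀∈)

Descent : (State → Set) → (State → ℕ) → State → Set
Descent P μ T = ∀ T′ → μ T′ < μ T → P T′ → WNSTO (eqs T′)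

by-descent : ∀ {P : State → Set} (μ : State → ℕ) → (∀ T → P T → Descent P μ T → WNSTO (eqs T)) →
  ∀ T → P T → WNSTO (eqs T)
by-descent {P} μ step T = go T (<-wellFounded (μ T))
  where
  go : ∀ T → Acc _<_ (μ T) → P T → WNSTO (eqs T)
  go T (acc smaller) p = step T p (λ T′ lt p′ → go T′ (smaller lt) p′)

data Located (k : Tag) : State → Set where
  at : ∀ T₁ s t T₂ → Located k (T₁ ++ (k , s , t) ∷ T₂)

Untagged : Tag → State → Set
Untagged k = All (λ e → proj₁ e ≢ k)

locate : ∀ k T → Located k T ⊎ Untagged k T
locate k []             = inj₂ []
locate k ((k′ , e) ∷ T) with k′ ≟ᵗ k | locate k T
... | yes refl | _                   = inj₁ (at [] _ _ T)
... | no _     | inj₁ (at T₁ s t T₂) = inj₁ (at ((k′ , e) ∷ T₁) s t T₂)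
... | no k′≢k  | inj₂ untagged       = inj₂ (k′≢k ∷ untagged)

terms-untagged : ∀ σ {k} T → Untagged k T → terms σ k T ≡ []
terms-untagged σ []                 []                = refl
terms-untagged σ {k} ((k′ , e) ∷ T) (k′≢k ∷ untagged) with k ≟ᵗ k′
... | yes k≡k′ = contradiction (sym k≡k′) k′≢k
... | no  _    = terms-untagged σ T untagged

only-solved : ∀ {k} → k ≢ input × k ≢ output → k ≡ solved
only-solved {solved} _              = refl
only-solved {input}  (k≢input , _)  = contradiction refl k≢input
only-solved {output} (_ , k≢output) = contradiction refl k≢output

solved-state-halts : ∀ T → SolvedOnce T → All (λ e → proj₁ e ≡ solved) T → WNSTO (eqs T)
solved-state-halts T once all-solved = eqs T , ε , inj₂ (solved-halts (eqs T) (All.tabulate solvedIn))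
  where
  solvedIn : ∀ {e} → e ∈ eqs T → SolvedIn (eqs T) e
  solvedIn e∈ with _ , ke∈ , refl ← ∈-map⁻ proj₂ e∈ with refl ← All.lookup all-solved ke∈ =
    once ke∈

m+n≤1⇒n≡0 : ∀ {m n} → 1 ≤ m → m + n ≤ 1 → n ≡ 0
m+n≤1⇒n≡0 {suc m} _ (s≤s m+n≤0) = n≤0⇒n≡0 (m+n≤o⇒n≤o m m+n≤0)

apart-mono : ∀ {m n m′ n′} → m′ ≤ m → n′ ≤ n → m ≡ 0 ⊎ n ≡ 0 → m′ ≡ 0 ⊎ n′ ≡ 0
apart-mono m′≤m _    (inj₁ refl) = inj₁ (n≤0⇒n≡0 m′≤m)
apart-mono _    n′≤n (inj₂ refl) = inj₂ (n≤0⇒n≡0 n′≤n)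

-- Without input equations

NoInputs : State → Set
NoInputs = Untagged input

outputSize : State → ℕ
outputSize T = sizes (terms rhs output T)

outputs-at-most-once : ∀ {T} → NoInputs T → Invariant T → ∀ x → count x rhs output T ≤ 1
outputs-at-most-once {T} noIn inv x = inv .outputs-linear x (cong (occs x) (terms-untagged rhs T noIn))

Invariant-without-inputs : ∀ {T} → NoInputs T → SolvedOnce T →
  (∀ x → count x lhs output T ≡ 0 ⊎ count x rhs output T ≡ 0) → (∀ x → count x rhs output T ≤ 1) →
  Invariant T
Invariant-without-inputs {T} noIn once apart at-most-once = record
  { solved-once    = once
  ; inputs-ground  = λ x → cong (occs x) (terms-untagged lhs T noIn)
  ; outputs-apart  = apart
  ; outputs-linear = λ x _ → at-most-once x
  }

NoInputs-eliminated : ∀ T₁ k e T₂ v u → NoInputs (T₁ ++ (k , e) ∷ T₂) → NoInputs (eliminated T₁ v u T₂)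
NoInputs-eliminated T₁ k e T₂ v u noIn with noIn₁ , _ ∷ noIn₂ ← All.++⁻ T₁ noIn =
  All.++⁺ (All.map⁺ noIn₁) ((λ ()) ∷ All.map⁺ noIn₂)

NoInputs-decomposed : ∀ T₁ k e ss ts T₂ → k ≢ input →
  NoInputs (T₁ ++ (k , e) ∷ T₂) → NoInputs (T₁ ++ zipˢ k ss ts ++ T₂)
NoInputs-decomposed T₁ k e ss ts T₂ k≢input noIn with noIn₁ , _ ∷ noIn₂ ← All.++⁻ T₁ noIn =
  All.++⁺ noIn₁ (All.++⁺ (All.map⁺ (All.universal (λ _ → k≢input) (zip ss ts))) noIn₂)

module OutputVariable (T₁ : State) (y : ℕ) (r : Term) (T₂ : State)
                      (inv : Invariant (T₁ ++ (output , var y , r) ∷ T₂))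
                      (noIn : NoInputs (T₁ ++ (output , var y , r) ∷ T₂)) where
  private
    T : State
    T = T₁ ++ (output , var y , r) ∷ T₂

    at-most-once = outputs-at-most-once noIn inv

    y∉rhs : occ y r + occs y (terms rhs output T₁ ++ terms rhs output T₂) ≡ 0
    y∉rhs with inv .outputs-apart y
    ... | inj₂ y∉RO = trans (sym (count-redex y rhs T₁ output (var y , r) T₂)) y∉RO
    ... | inj₁ y∉LO = contradiction refl (occ-var≡0⇒≢ {y} (m+n≡0⇒m≡0 _
                        (trans (sym (count-redex y lhs T₁ output (var y , r) T₂)) y∉LO)))

    y∉r = m+n≡0⇒m≡0 (occ y r) y∉rhs

  open Elimination T₁ y r T₂ y∉r
  open Elimination T₁ y r T₂ y∉r public using (eliminate-step)

  private
    T′ : State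
    T′ = eliminated T₁ y r T₂

    rhs-outputs-eliminated : terms rhs output T′ ≡ rest rhs output
    rhs-outputs-eliminated = terms-eliminated-fresh rhs (λ ()) (m+n≡0⇒n≡0 (occ y r) y∉rhs)

    rhs-outputs-≤ : ∀ z → count z rhs output T′ ≤ count z rhs output T
    rhs-outputs-≤ z rewrite rhs-outputs-eliminated = rest-≤-count z rhs T₁ output (var y , r) T₂

    -- A variable of r occurs nowhere else on the right, by linearity, so it may now appear on the left.
    outputs-apart-eliminated : ∀ z → count z lhs output T′ ≡ 0 ⊎ count z rhs output T′ ≡ 0
    outputs-apart-eliminated z with z ≟ y | occ z r ≟ 0
    ... | yes refl | _        = inj₁ (count-eliminated-self lhs (λ ()))
    ... | no z≢y   | yes z∉r  =
      apart-mono (≤-trans (≤-reflexive (count-eliminated-≢ lhs (λ ()) z≢y z∉r))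
                          (rest-≤-count z lhs T₁ output (var y , r) T₂))
                 (rhs-outputs-≤ z) (inv .outputs-apart z)
    ... | no _     | no z∈r   = inj₂ (trans (cong (occs z) rhs-outputs-eliminated)
      (m+n≤1⇒n≡0 (n≢0⇒n>0 z∈r)
                 (subst (_≤ 1) (count-redex z rhs T₁ output (var y , r) T₂) (at-most-once z))))

  Invariant-eliminated : Invariant T′ × NoInputs T′
  Invariant-eliminated =
    Invariant-without-inputs noIn′ (SolvedOnce-eliminated (inj₁ refl) (inv .solved-once))
                             outputs-apart-eliminated (λ z → ≤-trans (rhs-outputs-≤ z) (at-most-once z)) ,
    noIn′
    where noIn′ = NoInputs-eliminated T₁ output (var y , r) T₂ y r noIn

  outputSize-eliminated : outputSize T′ < outputSize T
  outputSize-eliminated rewrite rhs-outputs-eliminated = rest-<-sizes rhs T₁ output (var y , r) T₂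

module OutputTerm (T₁ : State) (s : Term) (X : ℕ) (T₂ : State)
                  (inv : Invariant (T₁ ++ (output , s , var X) ∷ T₂))
                  (noIn : NoInputs (T₁ ++ (output , s , var X) ∷ T₂)) where
  private
    T : State
    T = T₁ ++ (output , s , var X) ∷ T₂

    at-most-once = outputs-at-most-once noIn inv

    X-once : 1 ≤ occ X (var X)
    X-once = ≤-reflexive (sym (occ-self X))

    X∉rest-rhs : occs X (terms rhs output T₁ ++ terms rhs output T₂) ≡ 0
    X∉rest-rhs =
      m+n≤1⇒n≡0 X-once (subst (_≤ 1) (count-redex X rhs T₁ output (s , var X) T₂) (at-most-once X))

    X∉lhs : occ X s + occs X (terms lhs output T₁ ++ terms lhs output T₂) ≡ 0
    X∉lhs with inv .outputs-apart X
    ... | inj₁ X∉LO = trans (sym (count-redex X lhs T₁ output (s , var X) T₂)) X∉LO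
    ... | inj₂ X∉RO = contradiction (trans (sym (count-redex X rhs T₁ output (s , var X) T₂)) X∉RO)
                                    (<⇒≢ (≤-trans X-once (m≤m+n _ _)) ∘ sym)

    X∉s = m+n≡0⇒m≡0 (occ X s) X∉lhs

  open Elimination T₁ X s T₂ X∉s
  open Elimination T₁ X s T₂ X∉s public using (eliminate-step)

  private
    T′ : State
    T′ = eliminated T₁ X s T₂

    outputs-≤ : ∀ σ → occs X (rest σ output) ≡ 0 → ∀ z → count z σ output T′ ≤ count z σ output T
    outputs-≤ σ X∉rest z rewrite terms-eliminated-fresh σ (λ ()) X∉rest =
      rest-≤-count z σ T₁ output (s , var X) T₂

    lhs-outputs-≤ = outputs-≤ lhs (m+n≡0⇒n≡0 (occ X s) X∉lhs)
    rhs-outputs-≤ = outputs-≤ rhs X∉rest-rhs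

  Invariant-eliminated : Invariant T′ × NoInputs T′
  Invariant-eliminated =
    Invariant-without-inputs noIn′ (SolvedOnce-eliminated (inj₂ refl) (inv .solved-once))
                             (λ z → apart-mono (lhs-outputs-≤ z) (rhs-outputs-≤ z) (inv .outputs-apart z))
                             (λ z → ≤-trans (rhs-outputs-≤ z) (at-most-once z)) ,
    noIn′
    where noIn′ = NoInputs-eliminated T₁ output (s , var X) T₂ X s noIn

  outputSize-eliminated : outputSize T′ < outputSize T
  outputSize-eliminated rewrite terms-eliminated-fresh rhs (λ ()) X∉rest-rhs =
    rest-<-sizes rhs T₁ output (s , var X) T₂

outputs-phase : ∀ T → Invariant T × NoInputs T → WNSTO (eqs T)
outputs-phase = by-descent outputSize step
  where
  step : ∀ T → Invariant T × NoInputs T → Descent (λ T → Invariant T × NoInputs T) outputSize T →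
    WNSTO (eqs T)
  step T (inv , noIn) ih with locate output T
  ... | inj₂ noOut = solved-state-halts T (inv .solved-once) (All.zipWith only-solved (noIn , noOut))
  ... | inj₁ (at T₁ (var y) r T₂) =
    eliminate-step output (ih _ outputSize-eliminated Invariant-eliminated)
    where open OutputVariable T₁ y r T₂ inv noIn
  ... | inj₁ (at T₁ (fn f ss) (var X) T₂) =
    orient-step T₁ output f ss X T₂ (eliminate-step output (ih _ outputSize-eliminated Invariant-eliminated))
    where open OutputTerm T₁ (fn f ss) X T₂ inv noIn
  ... | inj₁ (at T₁ (fn f ss) (fn g ts) T₂) with f ≟ g | length ss ≟ length ts
  ...   | no f≢g   | _       = clash-step T₁ output f g ss ts T₂ (inj₁ f≢g)
  ...   | yes _    | no ≢len = clash-step T₁ output f g ss ts T₂ (inj₂ ≢len)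
  ...   | yes refl | yes same-arity =
    decompose-step (ih _ (sizes-decomposed rhs)
      (Invariant-decomposed (λ ()) inv , NoInputs-decomposed T₁ output _ ss ts T₂ (λ ()) noIn))
    where open Decomposition T₁ output f ss ts T₂ same-arity

-- With input equations

inputSize : State → ℕ
inputSize T = sizes (terms lhs input T)

redex-ground : ∀ {T₁ s t T₂} → Invariant (T₁ ++ (input , s , t) ∷ T₂) → Ground s
redex-ground {T₁} {s} {t} {T₂} inv x =
  m+n≡0⇒m≡0 (occ x s) (trans (sym (count-redex x lhs T₁ input (s , t) T₂)) (inv .inputs-ground x))

module InputTerm (T₁ : State) (g : Term) (X : ℕ) (T₂ : State)
                 (inv : Invariant (T₁ ++ (input , g , var X) ∷ T₂)) where
  private
    T : State
    T = T₁ ++ (input , g , var X) ∷ T₂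

    g-ground : Ground g
    g-ground = redex-ground inv

    rest-lhs-ground : ∀ z → occs z (terms lhs input T₁ ++ terms lhs input T₂) ≡ 0
    rest-lhs-ground z =
      m+n≡0⇒n≡0 (occ z g) (trans (sym (count-redex z lhs T₁ input (g , var X) T₂)) (inv .inputs-ground z))

  open Elimination T₁ X g T₂ (g-ground X)
  open Elimination T₁ X g T₂ (g-ground X) public using (eliminate-step)

  private
    T′ : State
    T′ = eliminated T₁ X g T₂

    lhs-inputs-eliminated : terms lhs input T′ ≡ rest lhs input
    lhs-inputs-eliminated = terms-eliminated-fresh lhs (λ ()) (rest-lhs-ground X)

    outputs-kept : ∀ σ {z} → z ≢ X → count z σ output T′ ≡ count z σ output T
    outputs-kept σ {z} z≢X = trans (count-eliminated-≢ σ (λ ()) z≢X (g-ground z))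
                                   (sym (cong (occs z) (terms-there σ T₁ (g , var X) T₂ (λ ()))))

    outputs-apart-eliminated : ∀ z → count z lhs output T′ ≡ 0 ⊎ count z rhs output T′ ≡ 0
    outputs-apart-eliminated z with z ≟ X
    ... | yes refl = inj₁ (count-eliminated-self lhs (λ ()))
    ... | no z≢X rewrite outputs-kept lhs z≢X | outputs-kept rhs z≢X = inv .outputs-apart z

    outputs-linear-eliminated : ∀ z → count z rhs input T′ ≡ 0 → count z rhs output T′ ≤ 1
    outputs-linear-eliminated z z∉rhs-inputs′ with z ≟ X
    ... | yes refl = subst (_≤ 1) (sym (count-eliminated-self rhs (λ ()))) z≤n
    ... | no z≢X rewrite outputs-kept rhs z≢X = inv .outputs-linear z z∉rhs-inputs
      where
      z∉rhs-inputs : count z rhs input T ≡ 0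
      z∉rhs-inputs = trans (count-redex z rhs T₁ input (g , var X) T₂)
        (cong₂ _+_ (occ-var-≢ z≢X)
                   (trans (sym (count-eliminated-≢ rhs (λ ()) z≢X (g-ground z))) z∉rhs-inputs′))

  Invariant-eliminated : Invariant T′
  Invariant-eliminated = record
    { solved-once    = SolvedOnce-eliminated (inj₂ refl) (inv .solved-once)
    ; inputs-ground  = λ z → trans (cong (occs z) lhs-inputs-eliminated) (rest-lhs-ground z)
    ; outputs-apart  = outputs-apart-eliminated
    ; outputs-linear = outputs-linear-eliminated
    }

  inputSize-eliminated : inputSize T′ < inputSize T
  inputSize-eliminated rewrite lhs-inputs-eliminated = rest-<-sizes lhs T₁ input (g , var X) T₂

inputs-phase : ∀ T → Invariant T → WNSTO (eqs T)
inputs-phase = by-descent inputSize step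
  where
  step : ∀ T → Invariant T → Descent Invariant inputSize T → WNSTO (eqs T)
  step T inv ih with locate input T
  ... | inj₂ noIn = outputs-phase T (inv , noIn)
  ... | inj₁ (at T₁ (var v) t T₂) = contradiction refl (occ-var≡0⇒≢ {v} (redex-ground inv v))
  ... | inj₁ (at T₁ (fn f gs) (var X) T₂) =
    orient-step T₁ input f gs X T₂ (eliminate-step input (ih _ inputSize-eliminated Invariant-eliminated))
    where open InputTerm T₁ (fn f gs) X T₂ inv
  ... | inj₁ (at T₁ (fn f gs) (fn g ts) T₂) with f ≟ g | length gs ≟ length ts
  ...   | no f≢g   | _       = clash-step T₁ input f g gs ts T₂ (inj₁ f≢g)
  ...   | yes _    | no ≢len = clash-step T₁ input f g gs ts T₂ (inj₂ ≢len)
  ...   | yes refl | yes same-arity =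
    decompose-step (ih _ (sizes-decomposed lhs) (Invariant-decomposed (λ ()) inv))
    where open Decomposition T₁ input f gs ts T₂ same-arity

tagOf : Mode → Tag
tagOf In  = input
tagOf Out = output

moded : (as hs : List Term) → (Fin (length as) → Mode) → State
moded (a ∷ as) (h ∷ hs) md = (tagOf (md zero) , a , h) ∷ moded as hs (md ∘ suc)
moded _        _        _  = []

eqs-moded : ∀ as hs md → eqs (moded as hs md) ≡ zip as hs
eqs-moded []       _        md = refl
eqs-moded (_ ∷ _)  []       md = refl
eqs-moded (a ∷ as) (h ∷ hs) md = cong ((a , h) ∷_) (eqs-moded as hs (md ∘ suc))

moded-unsolved : ∀ as hs md {e} → (solved , e) ∉ moded as hs md
moded-unsolved (_ ∷ _)  (_ ∷ _)  md (here eq) with md zero | eq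
... | In  | ()
... | Out | ()
moded-unsolved (_ ∷ as) (_ ∷ hs) md (there e∈) = moded-unsolved as hs (md ∘ suc) e∈

count-moded-lhs-input : ∀ x as hs md → (∀ i → md i ≡ In → Ground (lookup as i)) →
  count x lhs input (moded as hs md) ≡ 0
count-moded-lhs-input x []       _        md ground = refl
count-moded-lhs-input x (_ ∷ _)  []       md ground = refl
count-moded-lhs-input x (a ∷ as) (h ∷ hs) md ground with md zero in md₀
... | In  = cong₂ _+_ (ground zero md₀ x) (count-moded-lhs-input x as hs (md ∘ suc) (ground ∘ suc))
... | Out = count-moded-lhs-input x as hs (md ∘ suc) (ground ∘ suc)

count-moded-≤ : ∀ x σ k as hs md → count x σ k (moded as hs md) ≤ occs x (side σ (as , hs))
count-moded-≤ x σ k []       _        md = z≤n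
count-moded-≤ x σ k (_ ∷ _)  []       md = z≤n
count-moded-≤ x σ k (a ∷ as) (h ∷ hs) md rewrite side-∷ σ {a} {h} {as} {hs} with k ≟ᵗ tagOf (md zero)
... | yes _ = +-monoʳ-≤ (occ x (side σ (a , h))) (count-moded-≤ x σ k as hs (md ∘ suc))
... | no  _ = ≤-trans (count-moded-≤ x σ k as hs (md ∘ suc)) (m≤n+m _ _)

count-∷-≥ : ∀ x σ k e T → count x σ k T ≤ count x σ k (e ∷ T)
count-∷-≥ x σ k (k′ , e) T with k ≟ᵗ k′
... | yes _ = m≤n+m _ _
... | no  _ = ≤-refl

-- The modes of A and H are indexed by Fin (length as) and Fin (length hs), whose lengths agree
-- only propositionally.
Aligned : ∀ {m n} → (Fin m → Mode) → (Fin n → Mode) → Set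
Aligned md mdʰ = ∀ i j → toℕ i ≡ toℕ j → md i ≡ mdʰ j

modes-aligned : ∀ (md : ∀ n → Fin n → Mode) {m n} → m ≡ n → Aligned (md m) (md n)
modes-aligned md refl i j i≡j = cong (md _) (toℕ-injective i≡j)

count-moded-rhs-input-≥ : ∀ x as hs md (mdʰ : Fin (length hs) → Mode) → length as ≡ length hs →
  Aligned md mdʰ → ∀ j → mdʰ j ≡ In → occ x (lookup hs j) ≤ count x rhs input (moded as hs md)
count-moded-rhs-input-≥ x (a ∷ as) (h ∷ hs) md mdʰ _ aligned zero mdʰ₀
  rewrite trans (aligned zero zero refl) mdʰ₀ = m≤m+n _ _
count-moded-rhs-input-≥ x (a ∷ as) (h ∷ hs) md mdʰ same-length aligned (suc j) mdʰⱼ =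
  ≤-trans (count-moded-rhs-input-≥ x as hs (md ∘ suc) (mdʰ ∘ suc) (suc-injective same-length)
                                   (λ i j → aligned (suc i) (suc j) ∘ cong suc) j mdʰⱼ)
          (count-∷-≥ x rhs input (tagOf (md zero) , a , h) (moded as hs (md ∘ suc)))

Invariant-moded : ∀ as hs md (mdʰ : Fin (length hs) → Mode) → length as ≡ length hs → Aligned md mdʰ →
  (∀ x → occs x as ≡ 0 ⊎ occs x hs ≡ 0) →
  (∀ i → md i ≡ In → Ground (lookup as i)) →
  (∀ x → 2 ≤ occs x hs → Σ (Fin (length hs)) λ j → mdʰ j ≡ In × 1 ≤ occ x (lookup hs j)) →
  Invariant (moded as hs md)
Invariant-moded as hs md mdʰ same-length aligned disjoint ground linear = record
  { solved-once    = λ e∈ → contradiction e∈ (moded-unsolved as hs md)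
  ; inputs-ground  = λ x → count-moded-lhs-input x as hs md ground
  ; outputs-apart  = λ x → apart-mono (count-moded-≤ x lhs output as hs md)
                                      (count-moded-≤ x rhs output as hs md) (disjoint x)
  ; outputs-linear = outputs-linear-moded
  }
  where
  outputs-linear-moded : ∀ x → count x rhs input (moded as hs md) ≡ 0 →
    count x rhs output (moded as hs md) ≤ 1
  outputs-linear-moded x x∉rhs-inputs with count x rhs output (moded as hs md) ≤? 1
  ... | yes ≤1 = ≤1
  ... | no  ≰1
    with j , mdʰⱼ≡In , x∈hⱼ ← linear x (≤-trans (≰⇒> ≰1) (count-moded-≤ x rhs output as hs md)) =
    contradiction (subst (1 ≤_) x∉rhs-inputs
                    (≤-trans x∈hⱼ (count-moded-rhs-input-≥ x as hs md mdʰ same-length aligned j mdʰⱼ≡In)))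
                  λ ()

lemma16 : (m : Moding) (A H : Atom) → VarDisjoint A H → InputGround m A →
          WeaklyLinear m H → WNSTO ((atomTerm A , atomTerm H) ∷ [])
lemma16 m (atom p as) (atom q hs) disjoint ground linear with p ≟ q | length as ≟ length hs
... | no p≢q   | _       = _ , ε , inj₁ (act2 [] [] p q as hs (inj₁ p≢q))
... | yes refl | no ≢len = _ , ε , inj₁ (act2 [] [] p p as hs (inj₂ ≢len))
... | yes refl | yes same-length =
  WNSTO-◅◅ (act1 [] [] p as hs same-length ◅ ε)
           (subst WNSTO (trans (eqs-moded as hs md) (sym (++-identityʳ (zip as hs)))) (inputs-phase _ inv₀))
  where
  md = m p (length as)
  inv₀ = Invariant-moded as hs md (m p (length hs)) same-length (modes-aligned (m p) same-length)
                         disjoint ground linear
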